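{- Let $K$ be a commutative semiring, $A$ a finite non-empty set and $\pi:\mathsf{Lit}_A\to K$ a $K$-interpretation such that $\pi(L)\cdot\pi(\neg L)=0$ for every $L\in\mathsf{Lit}_A$. Then $\pi[\![\phi]\!]\cdot\pi[\![\neg\phi]\!]=0$ for every first-order sentence $\phi$.
   Context: A commutative semiring $(K,+,\cdot,0,1)$ has $0\neq1$, commutative monoids $(K,+,0)$, $(K,\cdot,1)$, distributivity and $0\cdot a=0$. For a finite relational vocabulary $\mathscr V$ and finite non-empty $A$, $\mathsf{Lit}_A$ is the set of ground atoms $R(\mathbf a)$ and their negations, with $\neg\neg R(\mathbf a)$ identified with $R(\mathbf a)$. $\mathsf{nnf}$ is the standard negation normal form (built from literals and $x=y$, $x\ne y$ with $\wedge,\vee,\exists,\forall$). A $K$-interpretation $\pi:\mathsf{Lit}_A\to K$ is extended to formulas under valuations $\nu$ into $A$: literals are evaluated by $\pi$ at their ground instances, $x=y$/$x\neq y$ get $1$ if true and $0$ otherwise, $\wedge\mapsto\cdot$, $\vee\mapsto+$, $\exists x\mapsto\sum_{a\in A}$, $\forall x\mapsto\prod_{a\in A}$ (over $\nu[x\mapsto a]$), and $\pi[\![\neg\phi]\!]_\nu=\pi[\![\mathsf{nnf}(\neg\phi)]\!]_\nu$; for sentences write $\pi[\![\phi]\!]$. -}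

module Defs where

open import Level using (Level)
open import Data.Nat using (ℕ; zero; suc)
open import Data.Fin using (Fin; zero; suc; _≟_)
open import Data.Vec using (Vec; map)
open import Data.Product using (Σ; _,_)
open import Relation.Nullary using (yes; no)
open import Algebra.Bundles using (CommutativeSemiring)

record Vocabulary : Set where
  field
    nRel  : ℕ
    arity : Fin nRel → ℕ
open Vocabulary public

-- The finite non-empty universe A is represented as Fin (suc k).
-- Ground atoms R(a) over A.
GroundAtom : Vocabulary → ℕ → Set
GroundAtom V k = Σ (Fin (nRel V)) λ R → Vec (Fin (suc k)) (arity V R)

data Lit (V : Vocabulary) (k : ℕ) : Set where
  pos : GroundAtom V k → Lit V k
  neg : GroundAtom V k → Lit V k

¬L : ∀ {V k} → Lit V k → Lit V k
¬L (pos a) = neg a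
¬L (neg a) = pos a

data Formula (V : Vocabulary) (n : ℕ) : Set where
  rel  : (R : Fin (nRel V)) → Vec (Fin n) (arity V R) → Formula V n
  eq   : Fin n → Fin n → Formula V n
  ¬'   : Formula V n → Formula V n
  _∧'_ : Formula V n → Formula V n → Formula V n
  _∨'_ : Formula V n → Formula V n → Formula V n
  ∃'   : Formula V (suc n) → Formula V n
  ∀'   : Formula V (suc n) → Formula V n

Sentence : Vocabulary → Set
Sentence V = Formula V 0

data NNF (V : Vocabulary) (n : ℕ) : Set where
  posR : (R : Fin (nRel V)) → Vec (Fin n) (arity V R) → NNF V n
  negR : (R : Fin (nRel V)) → Vec (Fin n) (arity V R) → NNF V n
  eqN  : Fin n → Fin n → NNF V n
  neqN : Fin n → Fin n → NNF V n
  andN : NNF V n → NNF V n → NNF V n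
  orN  : NNF V n → NNF V n → NNF V n
  exN  : NNF V (suc n) → NNF V n
  allN : NNF V (suc n) → NNF V n

mutual
  nnf : ∀ {V n} → Formula V n → NNF V n
  nnf (rel R xs) = posR R xs
  nnf (eq x y)   = eqN x y
  nnf (¬' φ)     = nnfNeg φ
  nnf (φ ∧' ψ)   = andN (nnf φ) (nnf ψ)
  nnf (φ ∨' ψ)   = orN (nnf φ) (nnf ψ)
  nnf (∃' φ)     = exN (nnf φ)
  nnf (∀' φ)     = allN (nnf φ)

  nnfNeg : ∀ {V n} → Formula V n → NNF V n
  nnfNeg (rel R xs) = negR R xs
  nnfNeg (eq x y)   = neqN x y
  nnfNeg (¬' φ)     = nnf φ
  nnfNeg (φ ∧' ψ)   = orN (nnfNeg φ) (nnfNeg ψ)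
  nnfNeg (φ ∨' ψ)   = andN (nnfNeg φ) (nnfNeg ψ)
  nnfNeg (∃' φ)     = allN (nnfNeg φ)
  nnfNeg (∀' φ)     = exN (nnfNeg φ)

extend : ∀ {n k} → (Fin n → Fin (suc k)) → Fin (suc k) → Fin (suc n) → Fin (suc k)
extend ν a zero    = a
extend ν a (suc i) = ν i

module Semantics {c ℓ : Level} (K : CommutativeSemiring c ℓ) where
  open CommutativeSemiring K using (Carrier; _+_; _*_; 0#; 1#)

  sumFin : ∀ {m} → (Fin m → Carrier) → Carrier
  sumFin {zero}  f = 0#
  sumFin {suc m} f = f zero + sumFin (λ i → f (suc i))

  prodFin : ∀ {m} → (Fin m → Carrier) → Carrier
  prodFin {zero}  f = 1#
  prodFin {suc m} f = f zero * prodFin (λ i → f (suc i))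

  Interpretation : Vocabulary → ℕ → Set c
  Interpretation V k = Lit V k → Carrier

  eqVal : ∀ {k} → Fin k → Fin k → Carrier
  eqVal a b with a ≟ b
  ... | yes _ = 1#
  ... | no  _ = 0#

  neqVal : ∀ {k} → Fin k → Fin k → Carrier
  neqVal a b with a ≟ b
  ... | yes _ = 0#
  ... | no  _ = 1#

  evalNNF : ∀ {V k n} → Interpretation V k → NNF V n → (Fin n → Fin (suc k)) → Carrier
  evalNNF π (posR R xs) ν = π (pos (R , map ν xs))
  evalNNF π (negR R xs) ν = π (neg (R , map ν xs))
  evalNNF π (eqN x y)   ν = eqVal (ν x) (ν y)
  evalNNF π (neqN x y)  ν = neqVal (ν x) (ν y)
  evalNNF π (andN φ ψ)  ν = evalNNF π φ ν * evalNNF π ψ ν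
  evalNNF π (orN φ ψ)   ν = evalNNF π φ ν + evalNNF π ψ ν
  evalNNF π (exN φ)     ν = sumFin (λ a → evalNNF π φ (extend ν a))
  evalNNF π (allN φ)    ν = prodFin (λ a → evalNNF π φ (extend ν a))

  ⟦_⟧_ : ∀ {V k n} → Interpretation V k → Formula V n → (Fin n → Fin (suc k)) → Carrier
  ⟦ π ⟧ φ = evalNNF π (nnf φ)

  ν₀ : ∀ {k} → Fin 0 → Fin (suc k)
  ν₀ ()

module Submission where

-- Call a, b ∈ K *annihilating* (a ⊥ b) when a · b = 0.  The
-- theorem says that the values of a sentence and of its negation always
-- annihilate.  We prove the stronger statement for every formula φ and
-- every valuation ν, namely
--     evalNNF π (nnf φ) ν ⊥ evalNNF π (nnfNeg φ) ν,
-- by structural induction on φ.  Negation normal form dualises the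
-- connectives (∧ ↔ ∨, ∃ ↔ ∀, = ↔ ≠, R ↔ ¬R), so each inductive step is an
-- instance of a purely algebraic closure property of ⊥ in an arbitrary
-- commutative semiring:
--   * ⊥ is symmetric;
--   * a ⊥ c and b ⊥ d imply (a + b) ⊥ (c · d), and (a · b) ⊥ (c + d);
--   * pointwise annihilation of f and g gives Σᵢ f i ⊥ Πᵢ g i.
-- Literals are the hypothesis on π and (in)equalities are checked by cases.

open import Defs
open import Level using (Level)
open import Data.Nat using (ℕ; suc)
open import Data.Fin using (Fin; zero; suc; _≟_)
open import Relation.Nullary using (¬_; yes; no)
open import Algebra.Bundles using (CommutativeSemiring)
import Algebra.Properties.CommutativeSemigroup as CommSemigroupProperties
import Relation.Binary.Reasoning.Setoid as SetoidReasoning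

module Annihilation {c ℓ : Level} (K : CommutativeSemiring c ℓ) where
  open CommutativeSemiring K hiding (zero)
  open Semantics K
  open SetoidReasoning setoid
  open CommSemigroupProperties *-commutativeSemigroup using (xy∙z≈xz∙y)

  _⊥_ : Carrier → Carrier → Set ℓ
  a ⊥ b = a * b ≈ 0#

  ⊥-sym : ∀ {a b} → a ⊥ b → b ⊥ a
  ⊥-sym {a} {b} a⊥b = trans (*-comm b a) a⊥b

  ⊥-absorbʳ : ∀ {a c} b → a ⊥ c → (a * b) ⊥ c
  ⊥-absorbʳ {a} {c} b a⊥c = begin
    (a * b) * c ≈⟨ xy∙z≈xz∙y a b c ⟩
    (a * c) * b ≈⟨ *-congʳ a⊥c ⟩
    0# * b      ≈⟨ zeroˡ b ⟩
    0#          ∎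

  ⊥-absorbˡ : ∀ {b c} a → b ⊥ c → (a * b) ⊥ c
  ⊥-absorbˡ {b} {c} a b⊥c = begin
    (a * b) * c ≈⟨ *-assoc a b c ⟩
    a * (b * c) ≈⟨ *-congˡ b⊥c ⟩
    a * 0#      ≈⟨ zeroʳ a ⟩
    0#          ∎

  ⊥-+ʳ : ∀ {a c d} → a ⊥ c → a ⊥ d → a ⊥ (c + d)
  ⊥-+ʳ {a} {c} {d} a⊥c a⊥d = begin
    a * (c + d)   ≈⟨ distribˡ a c d ⟩
    a * c + a * d ≈⟨ +-cong a⊥c a⊥d ⟩
    0# + 0#       ≈⟨ +-identityˡ 0# ⟩
    0#            ∎

  ⊥-*-+ : ∀ {a b c d} → a ⊥ c → b ⊥ d → (a * b) ⊥ (c + d)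
  ⊥-*-+ {a} {b} a⊥c b⊥d = ⊥-+ʳ (⊥-absorbʳ b a⊥c) (⊥-absorbˡ a b⊥d)

  ⊥-+-* : ∀ {a b c d} → a ⊥ c → b ⊥ d → (a + b) ⊥ (c * d)
  ⊥-+-* a⊥c b⊥d = ⊥-sym (⊥-*-+ (⊥-sym a⊥c) (⊥-sym b⊥d))

  ⊥-sum-prod : ∀ {m} (f g : Fin m → Carrier) → (∀ i → f i ⊥ g i) →
               sumFin f ⊥ prodFin g
  ⊥-sum-prod {ℕ.zero} f g _ = zeroˡ 1#
  ⊥-sum-prod {suc m}  f g f⊥g =
    ⊥-+-* (f⊥g zero)
          (⊥-sum-prod (λ i → f (suc i)) (λ i → g (suc i)) (λ i → f⊥g (suc i)))

  eqVal⊥neqVal : ∀ {k} (a b : Fin k) → eqVal a b ⊥ neqVal a b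
  eqVal⊥neqVal a b with a ≟ b
  ... | yes _ = zeroʳ 1#
  ... | no  _ = zeroˡ 1#

  nnf⊥nnfNeg : ∀ {V k n} (π : Interpretation V k) →
    (∀ (L : Lit V k) → π L ⊥ π (¬L L)) →
    (φ : Formula V n) (ν : Fin n → Fin (suc k)) →
    evalNNF π (nnf φ) ν ⊥ evalNNF π (nnfNeg φ) ν
  nnf⊥nnfNeg π lit (rel R xs) ν = lit _
  nnf⊥nnfNeg π lit (eq x y)   ν = eqVal⊥neqVal (ν x) (ν y)
  nnf⊥nnfNeg π lit (¬' φ)     ν = ⊥-sym (nnf⊥nnfNeg π lit φ ν)
  nnf⊥nnfNeg π lit (φ ∧' ψ)   ν = ⊥-*-+ (nnf⊥nnfNeg π lit φ ν) (nnf⊥nnfNeg π lit ψ ν)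
  nnf⊥nnfNeg π lit (φ ∨' ψ)   ν = ⊥-+-* (nnf⊥nnfNeg π lit φ ν) (nnf⊥nnfNeg π lit ψ ν)
  nnf⊥nnfNeg π lit (∃' φ)     ν =
    ⊥-sum-prod _ _ (λ a → nnf⊥nnfNeg π lit φ (extend ν a))
  nnf⊥nnfNeg π lit (∀' φ)     ν =
    ⊥-sym (⊥-sum-prod _ _ (λ a → ⊥-sym (nnf⊥nnfNeg π lit φ (extend ν a))))

proposition8 : ∀ {c ℓ} (K : CommutativeSemiring c ℓ) →
    let open CommutativeSemiring K in
    let open Semantics K in
    ¬ (0# ≈ 1#) →
    (V : Vocabulary) (k : ℕ) (π : Interpretation V k) →
    (∀ (L : Lit V k) → π L * π (¬L L) ≈ 0#) →
    ∀ (φ : Sentence V) → (⟦ π ⟧ φ) ν₀ * (⟦ π ⟧ (¬' φ)) ν₀ ≈ 0#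
proposition8 K _ V k π lit φ = Annihilation.nnf⊥nnfNeg K π lit φ (Semantics.ν₀ K)
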